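{- There are infinitely many cubes which are sums of two tetrahedral numbers; i.e., there are infinitely many positive integers $z$ such that $z^3 = T_x + T_y$ for some positive integers $x, y$.
   Context: $T_n = \frac{n(n+1)(n+2)}{6}$ denotes the $n$-th tetrahedral number. -}

module Defs where

open import Data.Nat using (ℕ; suc; _*_; _/_)

-- n-th tetrahedral number T n = n(n+1)(n+2)/6 (the division is exact)
T : ℕ → ℕ
T n = (n * suc n * suc (suc n)) / 6

module Submission where

-- Write P n = n(n+1)(n+2) = 6·T n.  With m = n + 1 we have P n = m³ − m, so
-- for z > b the numbers x = z + b − 1 and y = z − b − 1 satisfy
--     P x + P y = (z+b)³ + (z−b)³ − 2z = 2z³ + 6zb² − 2z.
-- If moreover (b, z) solves the Pell-type equation 3b² = 2z² + 1, the right
-- hand side collapses to 6z³, i.e. z³ = T x + T y.  That equation has the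
-- solution (b, z) = (9, 11) and is preserved by (b, z) ↦ (5b + 4z, 6b + 5z),
-- which strictly increases z; iterating yields arbitrarily large cubes.
--
-- Solutions are parametrised
-- as z = b + v + 2, so that x = 2b + v + 1 and y = v + 1 are visibly positive.

open import Defs
open import Data.Nat using (ℕ; zero; suc; _+_; _*_; _/_; _^_; _<_; s≤s; z≤n)
open import Data.Nat.Properties
  using (*-distribʳ-+; *-cancelʳ-≡; +-cancelʳ-≡; m≤m+n; ≤-trans; ≤-reflexive; <-≤-trans)
open import Data.Nat.DivMod using (m*n/n≡m)
open import Data.Nat.Tactic.RingSolver using (solve-∀)
open import Data.Product using (∃-syntax; _×_; _,_)
open import Relation.Binary.PropositionalEquality using (_≡_; refl; sym; trans; cong; cong₂)
open Relation.Binary.PropositionalEquality.≡-Reasoning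

P : ℕ → ℕ
P n = n * suc n * suc (suc n)

tri : ℕ → ℕ
tri zero    = zero
tri (suc n) = tri n + suc n

tet : ℕ → ℕ
tet zero    = zero
tet (suc n) = tet n + tri (suc n)

tri-double : ∀ n → n * suc n ≡ tri n * 2
tri-double zero    = refl
tri-double (suc n) = begin
  suc n * suc (suc n)     ≡⟨ step n ⟩
  n * suc n + suc n * 2   ≡⟨ cong (_+ suc n * 2) (tri-double n) ⟩
  tri n * 2 + suc n * 2   ≡⟨ *-distribʳ-+ 2 (tri n) (suc n) ⟨
  (tri n + suc n) * 2     ∎
  where
  step : ∀ n → suc n * suc (suc n) ≡ n * suc n + suc n * 2
  step = solve-∀

P≡tet*6 : ∀ n → P n ≡ tet n * 6
P≡tet*6 zero    = refl
P≡tet*6 (suc n) = begin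
  P (suc n)                            ≡⟨ step n ⟩
  P n + 3 * (suc n * suc (suc n))      ≡⟨ cong₂ (λ a b → a + 3 * b) (P≡tet*6 n) (tri-double (suc n)) ⟩
  tet n * 6 + 3 * (tri (suc n) * 2)    ≡⟨ collect (tet n) (tri (suc n)) ⟩
  (tet n + tri (suc n)) * 6            ∎
  where
  step : ∀ n → suc n * suc (suc n) * suc (suc (suc n))
               ≡ n * suc n * suc (suc n) + 3 * (suc n * suc (suc n))
  step = solve-∀
  collect : ∀ a t → a * 6 + 3 * (t * 2) ≡ (a + t) * 6
  collect = solve-∀

T*6≡P : ∀ n → T n * 6 ≡ P n
T*6≡P n = begin
  T n * 6            ≡⟨ cong (λ q → q / 6 * 6) (P≡tet*6 n) ⟩
  tet n * 6 / 6 * 6  ≡⟨ cong (_* 6) (m*n/n≡m (tet n) 6) ⟩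
  tet n * 6          ≡⟨ P≡tet*6 n ⟨
  P n                ∎

P+succ≡cube : ∀ n → P n + suc n ≡ suc n ^ 3
P+succ≡cube = expand
  where
  expand : ∀ n → n * suc n * suc (suc n) + suc n ≡ suc n * (suc n * (suc n * 1))
  expand = solve-∀

-- (z + b)³ + (z − b)³ = 2z³ + 6zb², written with z = b + v + 2.
-- (The ring solver does not handle _^_, so cubes are expanded for it.)
sum-of-conjugate-cubes : ∀ b v →
  suc (suc (b + b + v)) ^ 3 + suc (suc v) ^ 3 ≡ 2 * (b + v + 2) ^ 3 + 2 * (b + v + 2) * (3 * (b * b))
sum-of-conjugate-cubes = expand
  where
  expand : ∀ b v → let p = suc (suc (b + b + v)); q = suc (suc v); z = b + v + 2 in
    p * (p * (p * 1)) + q * (q * (q * 1)) ≡ 2 * (z * (z * (z * 1))) + 2 * z * (3 * (b * b))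
  expand = solve-∀

tetrahedral-pair : ∀ b v →
  P (suc (b + b + v)) + P (suc v) + 2 * (b + v + 2)
    ≡ 2 * (b + v + 2) ^ 3 + 2 * (b + v + 2) * (3 * (b * b))
tetrahedral-pair b v = begin
  P x + P y + 2 * (b + v + 2)           ≡⟨ regroup (P x) (P y) b v ⟩
  (P x + suc x) + (P y + suc y)         ≡⟨ cong₂ _+_ (P+succ≡cube x) (P+succ≡cube y) ⟩
  suc x ^ 3 + suc y ^ 3                 ≡⟨ sum-of-conjugate-cubes b v ⟩
  2 * (b + v + 2) ^ 3 + 2 * (b + v + 2) * (3 * (b * b)) ∎
  where
  x = suc (b + b + v)
  y = suc v
  regroup : ∀ p q b v → p + q + 2 * (b + v + 2) ≡ (p + suc (suc (b + b + v))) + (q + suc (suc v))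
  regroup = solve-∀

cube-from-pell : ∀ b v → 3 * (b * b) ≡ 2 * ((b + v + 2) * (b + v + 2)) + 1 →
  (b + v + 2) ^ 3 * 6 ≡ P (suc (b + b + v)) + P (suc v)
cube-from-pell b v pell = +-cancelʳ-≡ (2 * z) _ _ (begin
  z ^ 3 * 6 + 2 * z                               ≡⟨ collapse z ⟨
  2 * z ^ 3 + 2 * z * (2 * (z * z) + 1)           ≡⟨ cong (λ t → 2 * z ^ 3 + 2 * z * t) pell ⟨
  2 * z ^ 3 + 2 * z * (3 * (b * b))               ≡⟨ tetrahedral-pair b v ⟨
  P (suc (b + b + v)) + P (suc v) + 2 * z         ∎)
  where
  z = b + v + 2
  collapse : ∀ z → 2 * (z * (z * (z * 1))) + 2 * z * (2 * (z * z) + 1) ≡ z * (z * (z * 1)) * 6 + 2 * z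
  collapse = solve-∀

-- The Pell-type equation 3b² = 2z² + 1 is preserved by (b, z) ↦ (5b + 4z, 6b + 5z):
-- the new sides differ from the old ones by the same quantity 72b² + 120bz + 48z².
pell-step : ∀ b z → 3 * (b * b) ≡ 2 * (z * z) + 1 →
  3 * ((5 * b + 4 * z) * (5 * b + 4 * z)) ≡ 2 * ((6 * b + 5 * z) * (6 * b + 5 * z)) + 1
pell-step b z pell = begin
  3 * ((5 * b + 4 * z) * (5 * b + 4 * z))           ≡⟨ expand₁ b z ⟩
  3 * (b * b) + Δ                                   ≡⟨ cong (_+ Δ) pell ⟩
  2 * (z * z) + 1 + Δ                               ≡⟨ expand₂ b z ⟨
  2 * ((6 * b + 5 * z) * (6 * b + 5 * z)) + 1       ∎
  where
  Δ = 72 * (b * b) + 120 * (b * z) + 48 * (z * z)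
  expand₁ : ∀ b z → 3 * ((5 * b + 4 * z) * (5 * b + 4 * z))
                  ≡ 3 * (b * b) + (72 * (b * b) + 120 * (b * z) + 48 * (z * z))
  expand₁ = solve-∀
  expand₂ : ∀ b z → 2 * ((6 * b + 5 * z) * (6 * b + 5 * z)) + 1
                  ≡ 2 * (z * z) + 1 + (72 * (b * b) + 120 * (b * z) + 48 * (z * z))
  expand₂ = solve-∀

-- A solution of 3b² = 2z² + 1 with z = b + v + 2 (so that z ≥ b + 2).
record PellSolution : Set where
  constructor pell-solution
  field
    b v  : ℕ
    pell : 3 * (b * b) ≡ 2 * ((b + v + 2) * (b + v + 2)) + 1

open PellSolution

apex : PellSolution → ℕ
apex s = b s + v s + 2

-- The step of pell-step in the (b, v) parametrisation: z' − b' − 2 = 2b + v.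
next : PellSolution → PellSolution
next (pell-solution b v pell) = pell-solution (5 * b + 4 * z) (b + b + v)
  (trans (pell-step b z pell) (cong (λ w → 2 * (w * w) + 1) (same-apex b v)))
  where
  z = b + v + 2
  same-apex : ∀ b v → 6 * b + 5 * (b + v + 2) ≡ 5 * b + 4 * (b + v + 2) + (b + b + v) + 2
  same-apex = solve-∀

orbit : ℕ → PellSolution
orbit zero    = pell-solution 9 0 refl
orbit (suc n) = next (orbit n)

apex-increases : ∀ s → apex s < apex (next s)
apex-increases (pell-solution b v _) =
  ≤-trans (m≤m+n (suc z) (10 * b + 4 * v + 7)) (≤-reflexive (regroup b v))
  where
  z = b + v + 2
  regroup : ∀ b v → suc (b + v + 2) + (10 * b + 4 * v + 7)
                  ≡ 5 * b + 4 * (b + v + 2) + (b + b + v) + 2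
  regroup = solve-∀

orbit-unbounded : ∀ n → n < apex (orbit n)
orbit-unbounded zero    = s≤s z≤n
orbit-unbounded (suc n) = <-≤-trans (s≤s (orbit-unbounded n)) (apex-increases (orbit n))

theorem5p4 : ∀ (N : ℕ) → ∃[ z ] ∃[ x ] ∃[ y ] (N < z × 0 < x × 0 < y × z ^ 3 ≡ T x + T y)
theorem5p4 N = z , x , y , orbit-unbounded N , s≤s z≤n , s≤s z≤n ,
  *-cancelʳ-≡ (z ^ 3) (T x + T y) 6 (begin
    z ^ 3 * 6              ≡⟨ cube-from-pell (b s) (v s) (pell s) ⟩
    P x + P y              ≡⟨ cong₂ _+_ (T*6≡P x) (T*6≡P y) ⟨
    T x * 6 + T y * 6      ≡⟨ *-distribʳ-+ 6 (T x) (T y) ⟨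
    (T x + T y) * 6        ∎)
  where
  s = orbit N
  z = apex s
  x = suc (b s + b s + v s)
  y = suc (v s)
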